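{- Let $k\geq3$ and $a\in A_k$. The following are equivalent: (i) $a\odot M_I(k)^*$ contains neither $(M_I(3)^*)^T$ nor $\overline{(M_I(3)^*)^T}$ as a configuration; (ii) no $b\in\mathcal P$ occurs in $a$; (iii) $a\odot M_I(k)^*\in\mathcal F_{\mathrm{RowCol}}$.
   Context: A binary bracelet is the lexicographically smallest element of an equivalence class of binary sequences under shifts ($a_1\dots a_k\mapsto a_2\dots a_ka_1$) and reversals ($a_1\dots a_k\mapsto a_k\dots a_1$); for $k\ge4$, $A_k$ is the set of binary bracelets of length $k$, and $A_3=\{000,111\}$. $\mathcal P$ is the set of sequences over $\{x,y\}$: $xyxy$, $xyxxy$, $yxxyx$, $yxxxxy$, $xxxxxy$, $xyxxxy$, $yxxxyx$, $xyyxxx$, $xxxyyx$, $xyyxxyy$, $xyyyxxx$; $b\in\mathcal P$ occurs in $a=a_1\dots a_k$ if $k\ge|b|$ and for some $i\in[k]$, $a_ia_{i+1}\dots a_{i+|b|-1}$ (indices mod $k$) equals $b$ with ($x\mapsto1,y\mapsto0$) or with ($x\mapsto0,y\mapsto1$). $M$ contains $M'$ as a configuration if a submatrix of $M$ equals $M'$ up to row and column permutations. For $k\ge3$, $M_I(k)$ is the $k\times k$ binary matrix whose row $i<k$ has ones exactly in columns $i,i+1$ and row $k$ in columns $1,k$; $M^*$ appends an all-zero last column; $\overline M$ exchanges $0,1$; $M^T$ is the transpose; $a\odot M$ complements each row $i$ with $a_i=1$. $M_V$ is the $4\times5$ matrix with rows $(1,1,0,0,0),(1,1,1,1,0),(0,0,1,1,0),(1,0,0,1,1)$.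 With $A_{\mathrm{RowCol}}=\{0001,0011,0111,00001,00011,00111,01111,000111\}$, $\mathcal F_{\mathrm{RowCol}}=\bigcup_{k\ge3}\{M_I(k)^*,\overline{M_I(k)^*}\}\cup\{a\odot M_I(|a|)^*:a\in A_{\mathrm{RowCol}}\}\cup\{M_V^*,\overline{M_V^*}\}$. -}

module Defs where

open import Data.Bool using (Bool; true; false; not; _∧_; _∨_; if_then_else_; _xor_)
open import Data.Nat using (ℕ; zero; suc; _+_; _≤_; _<_; _<ᵇ_; _≡ᵇ_)
open import Data.Nat.DivMod using (_mod_)
open import Data.Fin using (Fin; toℕ; fromℕ<)
open import Data.Vec using (Vec; []; _∷_; _∷ʳ_; lookup; reverse)
open import Data.List using (List; []; _∷_; length)
open import Data.List.Membership.Propositional using (_∈_)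
open import Data.Product using (Σ; ∃; _×_; _,_)
open import Data.Sum using (_⊎_)
open import Data.Empty using (⊥)
open import Relation.Nullary using (¬_; yes; no)
open import Relation.Binary.PropositionalEquality using (_≡_)
open import Function.Definitions using (Injective)
open import Data.Nat.Properties using (_<?_)

-- Binary sequences (as vectors; position i of the paper is index i-1)

shift : ∀ {k} → Vec Bool k → Vec Bool k
shift []       = []
shift (x ∷ xs) = xs ∷ʳ x

data Equiv {k : ℕ} (a : Vec Bool k) : Vec Bool k → Set where
  here  : Equiv a a
  byShift : ∀ {b} → Equiv a b → Equiv a (shift b)
  byRev   : ∀ {b} → Equiv a b → Equiv a (reverse b)

data _≤lex_ : ∀ {k} → Vec Bool k → Vec Bool k → Set where
  lex-[] : [] ≤lex []
  lex-<  : ∀ {k} {xs ys : Vec Bool k} → (false ∷ xs) ≤lex (true ∷ ys)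
  lex-≡  : ∀ {k} {x} {xs ys : Vec Bool k} → xs ≤lex ys → (x ∷ xs) ≤lex (x ∷ ys)

Bracelet : ∀ {k} → Vec Bool k → Set
Bracelet a = ∀ b → Equiv a b → a ≤lex b

InA : (k : ℕ) → Vec Bool k → Set
InA 3 a = (a ≡ false ∷ false ∷ false ∷ []) ⊎ (a ≡ true ∷ true ∷ true ∷ [])
InA k a = Bracelet a

data XY : Set where
  x y : XY

interp : Bool → XY → Bool
interp φ x = φ
interp φ y = not φ

lookupL : (b : List XY) → Fin (length b) → XY
lookupL (c ∷ _)  Fin.zero    = c
lookupL (_ ∷ cs) (Fin.suc j) = lookupL cs j

𝒫 : List (List XY)
𝒫 = (x ∷ y ∷ x ∷ y ∷ [])
  ∷ (x ∷ y ∷ x ∷ x ∷ y ∷ [])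
  ∷ (y ∷ x ∷ x ∷ y ∷ x ∷ [])
  ∷ (y ∷ x ∷ x ∷ x ∷ x ∷ y ∷ [])
  ∷ (x ∷ x ∷ x ∷ x ∷ x ∷ y ∷ [])
  ∷ (x ∷ y ∷ x ∷ x ∷ x ∷ y ∷ [])
  ∷ (y ∷ x ∷ x ∷ x ∷ y ∷ x ∷ [])
  ∷ (x ∷ y ∷ y ∷ x ∷ x ∷ x ∷ [])
  ∷ (x ∷ x ∷ x ∷ y ∷ y ∷ x ∷ [])
  ∷ (x ∷ y ∷ y ∷ x ∷ x ∷ y ∷ y ∷ [])
  ∷ (x ∷ y ∷ y ∷ y ∷ x ∷ x ∷ x ∷ [])
  ∷ []

Occurs : List XY → ∀ {k} → Vec Bool k → Set
Occurs b {zero}  a = ⊥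
Occurs b {suc n} a =
  length b ≤ suc n ×
  Σ (Fin (suc n)) λ i → Σ Bool λ φ →
    ∀ (j : Fin (length b)) →
      lookup a ((toℕ i + toℕ j) mod (suc n)) ≡ interp φ (lookupL b j)

Mat : ℕ → ℕ → Set
Mat m n = Fin m → Fin n → Bool

MI : (k : ℕ) → Mat k k
MI k i j =
  let r = suc (toℕ i) ; c = suc (toℕ j) in
  if r <ᵇ k then (c ≡ᵇ r) ∨ (c ≡ᵇ suc r) else (c ≡ᵇ 1) ∨ (c ≡ᵇ k)

_* : ∀ {m n} → Mat m n → Mat m (suc n)
_* {m} {n} M i j with toℕ j <? n
... | yes p = M i (fromℕ< p)
... | no _  = false

‾_ : ∀ {m n} → Mat m n → Mat m n
(‾ M) i j = not (M i j)

_ᵀ : ∀ {m n} → Mat m n → Mat n m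
(M ᵀ) i j = M j i

_⊙_ : ∀ {m n} → Vec Bool m → Mat m n → Mat m n
(a ⊙ M) i j = if lookup a i then not (M i j) else M i j

-- M contains M' as a configuration: some submatrix of M equals M' up to
-- row and column permutations, i.e. there are injective row and column
-- maps under which the entries agree
Contains : ∀ {m n m' n'} → Mat m n → Mat m' n' → Set
Contains {m} {n} {m'} {n'} M M' =
  Σ (Fin m' → Fin m) λ f → Σ (Fin n' → Fin n) λ g →
    Injective _≡_ _≡_ f × Injective _≡_ _≡_ g ×
    (∀ i j → M (f i) (g j) ≡ M' i j)

MV : Mat 4 5
MV = tab
  where
  row : List Bool → Fin 5 → Bool
  row (b0 ∷ b1 ∷ b2 ∷ b3 ∷ b4 ∷ []) j = lookup (b0 ∷ b1 ∷ b2 ∷ b3 ∷ b4 ∷ []) j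
  row _ j = false
  tab : Mat 4 5
  tab Fin.zero                                  = row (true ∷ true ∷ false ∷ false ∷ false ∷ [])
  tab (Fin.suc Fin.zero)                        = row (true ∷ true ∷ true ∷ true ∷ false ∷ [])
  tab (Fin.suc (Fin.suc Fin.zero))              = row (false ∷ false ∷ true ∷ true ∷ false ∷ [])
  tab (Fin.suc (Fin.suc (Fin.suc Fin.zero)))    = row (true ∷ false ∷ false ∷ true ∷ true ∷ [])

A-RowCol : List (List Bool)
A-RowCol = (false ∷ false ∷ false ∷ true ∷ [])
         ∷ (false ∷ false ∷ true ∷ true ∷ [])
         ∷ (false ∷ true ∷ true ∷ true ∷ [])
         ∷ (false ∷ false ∷ false ∷ false ∷ true ∷ [])
         ∷ (false ∷ false ∷ false ∷ true ∷ true ∷ [])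
         ∷ (false ∷ false ∷ true ∷ true ∷ true ∷ [])
         ∷ (false ∷ true ∷ true ∷ true ∷ true ∷ [])
         ∷ (false ∷ false ∷ false ∷ true ∷ true ∷ true ∷ [])
         ∷ []

_≐_ : ∀ {m n} → Mat m n → Mat m n → Set
M ≐ N = ∀ i j → M i j ≡ N i j

data InFRowCol : ∀ {m n} → Mat m n → Set where
  fam-I     : ∀ k → 3 ≤ k → {M : Mat k (suc k)} → M ≐ (MI k *) → InFRowCol M
  fam-I‾    : ∀ k → 3 ≤ k → {M : Mat k (suc k)} → M ≐ (‾ (MI k *)) → InFRowCol M
  fam-A     : ∀ k (a : Vec Bool k) → Data.Vec.toList a ∈ A-RowCol →
              {M : Mat k (suc k)} → M ≐ (a ⊙ (MI k *)) → InFRowCol M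
  fam-V     : {M : Mat 4 6} → M ≐ (MV *) → InFRowCol M
  fam-V‾    : {M : Mat 4 6} → M ≐ (‾ (MV *)) → InFRowCol M

-- Write Δ = (M_I(3)^*)^T, the incidence matrix of a triangle with an extra zero row, and call
-- a simple if it is constant or lies in A_RowCol.  Simple sequences are exactly those with
-- a ⊙ M_I(k)^* ∈ F_RowCol, since a is recovered from any column of a ⊙ M_I(k)^*.
-- (i) ⇒ (ii): an occurrence of a pattern is a window of a ⊙ M_I(k)^* on which the rows and
-- columns of Δ (or of its complement, for the other colouring) can be placed; one explicit
-- placement per pattern is checked by computation.
-- (ii) ⇒ simple: for k ≤ 8 by exhaustive search over bracelets; for k ≥ 9, a change
-- a_s ≠ a_(s+1) would be the last two entries of a window of length 9, and every such window
-- contains a pattern, so a is constant.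
-- Simple ⇒ (i): M_I(k)^* contains no Δ because the k-cycle has no triangle for k ≥ 4, and no
-- complement of Δ because its rows have only two ones; the eight words of A_RowCol and k = 3
-- are checked by computation.

module Submission where

open import Defs
open import Data.Bool using (Bool; true; false; not; _∨_; T; if_then_else_)
open import Data.Bool.Properties
  using (T-∨; ∨-comm; not-involutive; not-injective; not-¬) renaming (_≟_ to _≟ᵇ_)
open import Data.Nat
  using (ℕ; zero; suc; _+_; _*_; _∸_; _≤_; _<_; _≡ᵇ_; _<ᵇ_; _≤?_; _<?_; z≤n; s≤s; s≤s⁻¹; NonZero)
open import Data.Nat.Properties
  using ( ≡ᵇ⇒≡; <ᵇ⇒<; <⇒<ᵇ; +-comm; +-assoc; +-suc; +-identityʳ; m∸n+n≡m; m≤m+n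
        ; ≤-antisym; ≤-trans; <-≤-trans; ≮⇒≥; <⇒≢)
  renaming (_≟_ to _≟ℕ_)
open import Data.Nat.DivMod
open import Data.Fin using (Fin; toℕ; fromℕ; fromℕ<; inject₁; #_)
open import Data.Fin.Properties
  using (all?; any?; _≟_; toℕ-injective; toℕ-fromℕ<; toℕ<n; toℕ-inject₁; toℕ-fromℕ)
open import Data.Vec using (Vec; []; _∷_; lookup; reverse; toList; fromList; tabulate)
open import Data.Vec.Properties
  using (lookup∘tabulate; tabulate∘lookup; tabulate-cong; lookup-replicate; toList∘fromList)
open import Data.Product using (Σ; ∃; _×_; _,_; proj₁; proj₂)
open import Data.Sum using (_⊎_; inj₁; inj₂; [_,_]′)
import Data.Sum as Sum
open import Data.Empty using (⊥)
open import Data.Unit using (⊤)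
open import Data.Maybe using (Maybe; just; nothing)
open import Data.List using (List; length)
import Data.List.Properties as List
open import Data.List.Relation.Unary.Any as Any using (Any)
open import Data.List.Relation.Binary.Prefix.Heterogeneous using (Prefix; []; _∷_)
open import Data.List.Relation.Binary.Infix.Heterogeneous using (Infix; here; there)
open import Data.List.Relation.Binary.Infix.Heterogeneous.Properties using (infix?; length-mono)
open import Data.List.Relation.Unary.All as All using (All; []; _∷_)
open import Data.List.Membership.Propositional using (_∈_; find)
open import Data.List.Membership.DecPropositional (List.≡-dec _≟ᵇ_) using (_∈?_)
open import Function using (_∘_; _$_)
open import Function.Bundles using (_⇔_; mk⇔; Equivalence)
open import Level using (0ℓ)
open import Relation.Nullary using (Dec; yes; no; ¬_; ¬?; contradiction)
open import Relation.Nullary.Decidable using (True; toWitness; map′; _×-dec_; _⊎-dec_; _→-dec_; does-⇔)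
open import Relation.Unary using (Pred; Decidable)
open import Relation.Binary.PropositionalEquality

Exhaustible : Set → Set₁
Exhaustible A = ∀ {P : Pred A 0ℓ} → Decidable P → Dec (∀ z → P z)

∀-Bool? : Exhaustible Bool
∀-Bool? P? = map′ (λ { (t , f) true → t ; (t , f) false → f }) (λ h → h true , h false)
                  (P? true ×-dec P? false)

∃-Bool? : ∀ {P : Pred Bool 0ℓ} → Decidable P → Dec (∃ P)
∃-Bool? P? = map′ (λ { (inj₁ t) → true , t ; (inj₂ f) → false , f })
                  (λ { (true , t) → inj₁ t ; (false , f) → inj₂ f })
                  (P? true ⊎-dec P? false)

∀-Vec? : ∀ {A} → Exhaustible A → ∀ n → Exhaustible (Vec A n)
∀-Vec? ∀? zero    P? = map′ (λ { p [] → p }) (_$ []) (P? [])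
∀-Vec? ∀? (suc n) P? = map′ (λ h → λ { (z ∷ v) → h z v }) (λ h z v → h (z ∷ v))
                             (∀? λ z → ∀-Vec? ∀? n (P? ∘ (z ∷_)))

_avoids_ : ∀ {m n m' n'} → Mat m n → Mat m' n' → Set
M avoids N = ¬ Contains M N × ¬ Contains M (‾ N)

Contains-resp : ∀ {m n m' n'} {M M' : Mat m n} {N N' : Mat m' n'} →
                M ≐ M' → N ≐ N' → Contains M N → Contains M' N'
Contains-resp M≐M' N≐N' (f , g , f-inj , g-inj , match) =
  f , g , f-inj , g-inj , λ i j → trans (sym (M≐M' (f i) (g j))) (trans (match i j) (N≐N' i j))

Contains-‾ : ∀ {m n m' n'} {M : Mat m n} {N : Mat m' n'} → Contains M N → Contains (‾ M) (‾ N)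
Contains-‾ (f , g , f-inj , g-inj , match) = f , g , f-inj , g-inj , λ i j → cong not (match i j)

‾-involutive : ∀ {m n} (M : Mat m n) → (‾ (‾ M)) ≐ M
‾-involutive M i j = not-involutive (M i j)

avoids-resp : ∀ {m n m' n'} {M M' : Mat m n} {N : Mat m' n'} → M ≐ M' → M avoids N → M' avoids N
avoids-resp M≐M' (¬N , ¬‾N) =
  ¬N ∘ Contains-resp M'≐M (λ _ _ → refl) , ¬‾N ∘ Contains-resp M'≐M (λ _ _ → refl)
  where M'≐M = λ i j → sym (M≐M' i j)

avoids-‾ : ∀ {m n m' n'} {M : Mat m n} {N : Mat m' n'} → M avoids N → (‾ M) avoids N
avoids-‾ {M = M} {N} (¬N , ¬‾N) =
    ¬‾N ∘ Contains-resp (‾-involutive M) (λ _ _ → refl) ∘ Contains-‾ {M = ‾ M}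
  , ¬N ∘ Contains-resp (‾-involutive M) (‾-involutive N) ∘ Contains-‾ {M = ‾ M}

RowsDistinct : ∀ {m n} → Mat m n → Set
RowsDistinct N = ∀ i i' → (∀ j → N i j ≡ N i' j) → i ≡ i'

rowsDistinct? : ∀ {m n} (N : Mat m n) → Dec (RowsDistinct N)
rowsDistinct? N = all? λ i → all? λ i' → (all? λ j → N i j ≟ᵇ N i' j) →-dec (i ≟ i')

RowsDistinct-‾ : ∀ {m n} {N : Mat m n} → RowsDistinct N → RowsDistinct (‾ N)
RowsDistinct-‾ distinct i i' same = distinct i i' (λ j → not-injective (same j))

contains-of-match : ∀ {m n m' n'} {M : Mat m n} {N : Mat m' n'} →
                    RowsDistinct N → RowsDistinct (N ᵀ) →
                    (f : Fin m' → Fin m) (g : Fin n' → Fin n) →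
                    (∀ i j → M (f i) (g j) ≡ N i j) → Contains M N
contains-of-match {M = M} rows cols f g match = f , g , f-injective , g-injective , match
  where
  f-injective : ∀ {i i'} → f i ≡ f i' → i ≡ i'
  f-injective {i} {i'} e = rows i i' λ j →
    trans (sym (match i j)) (trans (cong (λ r → M r (g j)) e) (match i' j))
  g-injective : ∀ {j j'} → g j ≡ g j' → j ≡ j'
  g-injective {j} {j'} e = cols j j' λ i →
    trans (sym (match i j)) (trans (cong (M (f i)) e) (match i j'))

Obstructed : ∀ {m n m' n'} → Mat m n → Mat m' n' → Set
Obstructed {n = n} {n' = n'} M N =
  ∀ (cs : Vec (Fin n) n') → ∃ λ p → ∀ r → ¬ (∀ q → M r (lookup cs q) ≡ N p q)

obstructed? : ∀ {m n m' n'} (M : Mat m n) (N : Mat m' n') → Dec (Obstructed M N)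
obstructed? M N = ∀-Vec? (λ P? → all? P?) _ λ cs →
  any? λ p → all? λ r → ¬? (all? λ q → M r (lookup cs q) ≟ᵇ N p q)

obstructed⇒¬contains : ∀ {m n m' n'} (M : Mat m n) {N : Mat m' n'} → Obstructed M N → ¬ Contains M N
obstructed⇒¬contains M obstructed (f , g , _ , _ , match) with obstructed (tabulate g)
... | p , unmatched = unmatched (f p) λ q → trans (cong (M (f p)) (lookup∘tabulate g q)) (match p q)

%-+-absorbˡ : ∀ m n k .{{_ : NonZero k}} → (m % k + n) % k ≡ (m + n) % k
%-+-absorbˡ m n k = begin
  (m % k + n) % k         ≡⟨ %-distribˡ-+ (m % k) n k ⟩
  (m % k % k + n % k) % k ≡⟨ cong (λ z → (z + n % k) % k) (m%n%n≡m%n m k) ⟩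
  (m % k + n % k) % k     ≡⟨ %-distribˡ-+ m n k ⟨
  (m + n) % k             ∎
  where open ≡-Reasoning

%-+-absorbʳ : ∀ m n k .{{_ : NonZero k}} → (m + n % k) % k ≡ (m + n) % k
%-+-absorbʳ m n k = begin
  (m + n % k) % k ≡⟨ %-congˡ (+-comm m (n % k)) ⟩
  (n % k + m) % k ≡⟨ %-+-absorbˡ n m k ⟩
  (n + m) % k     ≡⟨ %-congˡ (+-comm n m) ⟩
  (m + n) % k     ∎
  where open ≡-Reasoning

-- Adding j = k ∸ i % k completes i to a multiple of k.
+-%-cancelˡ : ∀ i {r c k} .{{_ : NonZero k}} → r < k → c < k → (i + r) % k ≡ (i + c) % k → r ≡ c
+-%-cancelˡ i {r} {c} {k} r<k c<k eq = begin
  r                     ≡⟨ m<n⇒m%n≡m r<k ⟨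
  r % k                 ≡⟨ complete r ⟩
  (j + (i + r)) % k     ≡⟨ %-+-absorbʳ j (i + r) k ⟨
  (j + (i + r) % k) % k ≡⟨ cong (λ z → (j + z) % k) eq ⟩
  (j + (i + c) % k) % k ≡⟨ %-+-absorbʳ j (i + c) k ⟩
  (j + (i + c)) % k     ≡⟨ complete c ⟨
  c % k                 ≡⟨ m<n⇒m%n≡m c<k ⟩
  c                     ∎
  where
  open ≡-Reasoning
  j = k ∸ i % k
  j+i : j + i ≡ suc (i / k) * k
  j+i = begin
    j + i                   ≡⟨ cong (j +_) (m≡m%n+[m/n]*n i k) ⟩
    j + (i % k + i / k * k) ≡⟨ +-assoc j (i % k) _ ⟨
    j + i % k + i / k * k   ≡⟨ cong (_+ i / k * k) (m∸n+n≡m (m%n≤n i k)) ⟩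
    k + i / k * k           ∎
  complete : ∀ z → z % k ≡ (j + (i + z)) % k
  complete z = begin
    z % k                     ≡⟨ [m+kn]%n≡m%n z (suc (i / k)) k ⟨
    (z + suc (i / k) * k) % k ≡⟨ %-congˡ (+-comm z _) ⟩
    (suc (i / k) * k + z) % k ≡⟨ %-congˡ (cong (_+ z) j+i) ⟨
    (j + i + z) % k           ≡⟨ %-congˡ (+-assoc j i z) ⟩
    (j + (i + z)) % k         ∎

-- The disjunction excludes the wrap-around r + 1 = k, c = 0.
+-%-cancelˡ-suc : ∀ i {r c k} .{{_ : NonZero k}} → r < k → c < k → suc r < k ⊎ 0 < c →
                  (i + c) % k ≡ (i + suc r) % k → c ≡ suc r
+-%-cancelˡ-suc i {r} {c} {k} r<k c<k no-wrap eq with suc r <? k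
... | yes r+1<k = +-%-cancelˡ i c<k r+1<k eq
... | no  r+1≮k = contradiction (+-%-cancelˡ i c<k (≤-trans (s≤s z≤n) c<k) (trans eq wraps)) c≢0
  where
  wraps : (i + suc r) % k ≡ (i + 0) % k
  wraps rewrite ≤-antisym r<k (≮⇒≥ r+1≮k) | +-identityʳ i = [m+n]%n≡m%n i k
  c≢0 : c ≢ 0
  c≢0 = [ (λ r+1<k → contradiction r+1<k r+1≮k) , (λ 0<c c≡0 → <⇒≢ 0<c (sym c≡0)) ]′ no-wrap

toℕ-mod : ∀ m k .{{_ : NonZero k}} → toℕ (m mod k) ≡ m % k
toℕ-mod m k = toℕ-fromℕ< _

mod-cong : ∀ {m m'} k .{{_ : NonZero k}} → m % k ≡ m' % k → m mod k ≡ m' mod k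
mod-cong {m} {m'} k eq = toℕ-injective (trans (toℕ-mod m k) (trans eq (sym (toℕ-mod m' k))))

mod-toℕ : ∀ {k} .{{_ : NonZero k}} (i : Fin k) → toℕ i mod k ≡ i
mod-toℕ i = toℕ-injective (trans (toℕ-mod _ _) (m<n⇒m%n≡m (toℕ<n i)))

toℕ-last : ∀ {n} (p : Fin (suc n)) → ¬ suc (toℕ p) < suc n → toℕ p ≡ n
toℕ-last p p+1≮k = ≤-antisym (s≤s⁻¹ (toℕ<n p)) (≮⇒≥ (p+1≮k ∘ s≤s))

MI-entry : ∀ {n} (p q : Fin (suc n)) →
           MI (suc n) p q ≡ (toℕ q ≡ᵇ toℕ p) ∨ (toℕ q ≡ᵇ suc (toℕ p) % suc n)
MI-entry {n} p q with suc (toℕ p) <ᵇ suc n in lt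
... | true  = cong (λ z → (toℕ q ≡ᵇ toℕ p) ∨ (toℕ q ≡ᵇ z))
                   (sym (m<n⇒m%n≡m (<ᵇ⇒< (suc (toℕ p)) (suc n) (subst T (sym lt) _))))
... | false = let p≡n = toℕ-last p (λ p+1<k → subst T lt (<⇒<ᵇ p+1<k)) in
  trans (∨-comm (toℕ q ≡ᵇ 0) (toℕ q ≡ᵇ n))
        (cong₂ (λ u v → (toℕ q ≡ᵇ u) ∨ (toℕ q ≡ᵇ v)) (sym p≡n)
               (sym (trans (cong (λ z → suc z % suc n) p≡n) (n%n≡0 (suc n)))))

-- Rows and columns I + r, I + c of M_I(k) carry the two diagonals of a window,
-- except for the wrap-around entry r = k - 1, c = 0.
MI-shifted : ∀ {n} I {r c} → r < suc n → c < suc n → suc r < suc n ⊎ 0 < c →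
             MI (suc n) ((I + r) mod suc n) ((I + c) mod suc n) ≡ (c ≡ᵇ r) ∨ (c ≡ᵇ suc r)
MI-shifted {n} I {r} {c} r<k c<k no-wrap =
  trans (MI-entry ((I + r) mod k) ((I + c) mod k))
        (cong₂ _∨_ (does-⇔ diagonal (_ ≟ℕ _) (c ≟ℕ r)) (does-⇔ off-diagonal (_ ≟ℕ _) (c ≟ℕ suc r)))
  where
  k = suc n
  diagonal : (toℕ ((I + c) mod k) ≡ toℕ ((I + r) mod k)) ⇔ (c ≡ r)
  diagonal = mk⇔
    (λ eq → +-%-cancelˡ I c<k r<k (trans (sym (toℕ-mod (I + c) k)) (trans eq (toℕ-mod (I + r) k))))
    λ { refl → refl }
  next : suc (toℕ ((I + r) mod k)) % k ≡ (I + suc r) % k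
  next = begin
    suc (toℕ ((I + r) mod k)) % k ≡⟨ cong (λ z → suc z % k) (toℕ-mod (I + r) k) ⟩
    (1 + (I + r) % k) % k         ≡⟨ %-+-absorbʳ 1 (I + r) k ⟩
    suc (I + r) % k               ≡⟨ %-congˡ (+-suc I r) ⟨
    (I + suc r) % k               ∎
    where open ≡-Reasoning
  off-diagonal : (toℕ ((I + c) mod k) ≡ suc (toℕ ((I + r) mod k)) % k) ⇔ (c ≡ suc r)
  off-diagonal = mk⇔
    (λ eq → +-%-cancelˡ-suc I r<k c<k no-wrap (trans (sym (toℕ-mod (I + c) k)) (trans eq next)))
    λ { refl → trans (toℕ-mod (I + suc r) k) (sym next) }

*-inject₁ : ∀ {m n} (M : Mat m n) i j → (M *) i (inject₁ j) ≡ M i j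
*-inject₁ {n = n} M i j with toℕ (inject₁ j) <? n
... | yes p = cong (M i) (toℕ-injective (trans (toℕ-fromℕ< p) (toℕ-inject₁ j)))
... | no ¬p = contradiction (subst (_< n) (sym (toℕ-inject₁ j)) (toℕ<n j)) ¬p

*-fromℕ : ∀ {m n} (M : Mat m n) i → (M *) i (fromℕ n) ≡ false
*-fromℕ {n = n} M i with toℕ (fromℕ n) <? n
... | yes p = contradiction (toℕ-fromℕ n) (<⇒≢ p)
... | no _  = refl

-- Occurrences of patterns give configurations

Δ : Mat 4 3
Δ = (MI 3 *) ᵀ

-- A window of L consecutive rows of M_I(k)^*, with the columns of the same positions
-- and the zero column (nothing).
pathEntry : ∀ {L} → Fin L → Maybe (Fin L) → Bool
pathEntry r (just c) = (toℕ c ≡ᵇ toℕ r) ∨ (toℕ c ≡ᵇ suc (toℕ r))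
pathEntry r nothing  = false

windowEntry : ∀ {L} → (Fin L → Bool) → Fin L → Maybe (Fin L) → Bool
windowEntry w r c = if w r then not (pathEntry r c) else pathEntry r c

Unwrapped : ∀ {L} → Fin L → Maybe (Fin L) → Set
Unwrapped {L} r (just c) = suc (toℕ r) < L ⊎ 0 < toℕ c
Unwrapped r nothing      = ⊤

unwrapped? : ∀ {L} (r : Fin L) (c : Maybe (Fin L)) → Dec (Unwrapped r c)
unwrapped? r (just c) = (suc (toℕ r) <? _) ⊎-dec (0 <? toℕ c)
unwrapped? r nothing  = yes _

record Embedding (L m' n' : ℕ) : Set where
  constructor embedding
  field
    rows : Vec (Fin L) m'
    cols : Vec (Maybe (Fin L)) n'

Realises : ∀ {L m' n'} → (Fin L → Bool) → Embedding L m' n' → Mat m' n' → Set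
Realises w (embedding rows cols) N = ∀ p q → let r = lookup rows p ; c = lookup cols q in
  Unwrapped r c × windowEntry w r c ≡ N p q

realises? : ∀ {L m' n'} (w : Fin L → Bool) (e : Embedding L m' n') (N : Mat m' n') → Dec (Realises w e N)
realises? w (embedding rows cols) N = all? λ p → all? λ q → let r = lookup rows p ; c = lookup cols q in
  unwrapped? r c ×-dec (windowEntry w r c ≟ᵇ N p q)

realises-not : ∀ {L m' n'} {w : Fin L → Bool} {e : Embedding L m' n'} {N : Mat m' n'} →
               Realises w e N → Realises (not ∘ w) e (‾ N)
realises-not {w = w} {embedding rows cols} realised p q with realised p q
... | unwrapped , entry = unwrapped , trans (flip (w (lookup rows p))) (cong not entry)
  where
  flip : ∀ b {d} → (if not b then not d else d) ≡ not (if b then not d else d)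
  flip true  = sym (not-involutive _)
  flip false = refl

module Window {n} (a : Vec Bool (suc n)) (I : ℕ) {L} (L≤k : L ≤ suc n) (w : Fin L → Bool)
              (reads : ∀ j → lookup a ((I + toℕ j) mod suc n) ≡ w j) where

  row : Fin L → Fin (suc n)
  row r = (I + toℕ r) mod suc n

  col : Maybe (Fin L) → Fin (suc (suc n))
  col (just c) = inject₁ (row c)
  col nothing  = fromℕ (suc n)

  path : ∀ r c → Unwrapped r c → (MI (suc n) *) (row r) (col c) ≡ pathEntry r c
  path r (just c) unwrapped = trans (*-inject₁ (MI (suc n)) (row r) (row c))
    (MI-shifted I (<-≤-trans (toℕ<n r) L≤k) (<-≤-trans (toℕ<n c) L≤k)
                  (Sum.map₁ (λ r+1<L → <-≤-trans r+1<L L≤k) unwrapped))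
  path r nothing _ = *-fromℕ (MI (suc n)) (row r)

  contains : ∀ {m' n'} (e : Embedding L m' n') {N : Mat m' n'} →
             RowsDistinct N → RowsDistinct (N ᵀ) → Realises w e N → Contains (a ⊙ (MI (suc n) *)) N
  contains (embedding rows cols) distinct-rows distinct-cols realised =
    contains-of-match {M = a ⊙ (MI (suc n) *)} distinct-rows distinct-cols
                      (row ∘ lookup rows) (col ∘ lookup cols) λ p q →
      let r = lookup rows p ; c = lookup cols q ; unwrapped , entry = realised p q in
      trans (cong₂ (λ b d → if b then not d else d) (reads r) (path r c unwrapped)) entry

interp-false : ∀ c → interp false c ≡ not (interp true c)
interp-false x = refl
interp-false y = refl

Realiser : List XY → Set
Realiser b = Σ (Embedding (length b) 4 3) λ e → Realises (interp true ∘ lookupL b) e Δ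

realiser : ∀ {b} (e : Embedding (length b) 4 3) →
           True (realises? (interp true ∘ lookupL b) e Δ) → Realiser b
realiser e ok = e , toWitness ok

realisers : All Realiser 𝒫
realisers =
    realiser (embedding (# 2 ∷ # 1 ∷ # 0 ∷ # 3 ∷ []) (just (# 1) ∷ just (# 2) ∷ nothing ∷ [])) _
  ∷ realiser (embedding (# 2 ∷ # 1 ∷ # 0 ∷ # 4 ∷ []) (just (# 1) ∷ just (# 2) ∷ nothing ∷ [])) _
  ∷ realiser (embedding (# 4 ∷ # 3 ∷ # 2 ∷ # 0 ∷ []) (just (# 3) ∷ just (# 4) ∷ nothing ∷ [])) _
  ∷ realiser (embedding (# 2 ∷ # 4 ∷ # 1 ∷ # 5 ∷ []) (just (# 1) ∷ just (# 3) ∷ just (# 4) ∷ [])) _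
  ∷ realiser (embedding (# 2 ∷ # 3 ∷ # 0 ∷ # 5 ∷ []) (just (# 1) ∷ just (# 2) ∷ just (# 4) ∷ [])) _
  ∷ realiser (embedding (# 2 ∷ # 4 ∷ # 0 ∷ # 1 ∷ []) (just (# 0) ∷ just (# 3) ∷ just (# 4) ∷ [])) _
  ∷ realiser (embedding (# 3 ∷ # 5 ∷ # 1 ∷ # 0 ∷ []) (just (# 2) ∷ just (# 3) ∷ just (# 5) ∷ [])) _
  ∷ realiser (embedding (# 3 ∷ # 4 ∷ # 0 ∷ # 1 ∷ []) (just (# 0) ∷ just (# 3) ∷ just (# 5) ∷ [])) _
  ∷ realiser (embedding (# 2 ∷ # 5 ∷ # 0 ∷ # 3 ∷ []) (just (# 1) ∷ just (# 2) ∷ just (# 5) ∷ [])) _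
  ∷ realiser (embedding (# 3 ∷ # 4 ∷ # 0 ∷ # 1 ∷ []) (just (# 0) ∷ just (# 3) ∷ just (# 5) ∷ [])) _
  ∷ realiser (embedding (# 4 ∷ # 5 ∷ # 0 ∷ # 1 ∷ []) (just (# 0) ∷ just (# 4) ∷ just (# 6) ∷ [])) _
  ∷ []

Δ-rows-distinct : RowsDistinct Δ
Δ-rows-distinct = toWitness {a? = rowsDistinct? Δ} _

Δ-cols-distinct : RowsDistinct (Δ ᵀ)
Δ-cols-distinct = toWitness {a? = rowsDistinct? (Δ ᵀ)} _

-- Reading x ↦ 0 complements the window, so the same embedding then realises ‾ Δ.
occurs⇒contains : ∀ {b k} {a : Vec Bool k} → b ∈ 𝒫 → Occurs b a →
                  Contains (a ⊙ (MI k *)) Δ ⊎ Contains (a ⊙ (MI k *)) (‾ Δ)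
occurs⇒contains {b} {suc n} {a} b∈𝒫 (L≤k , i , φ , reads) with All.lookup realisers b∈𝒫 | φ
... | e , realised | true  =
  inj₁ (Window.contains a (toℕ i) L≤k _ reads e Δ-rows-distinct Δ-cols-distinct realised)
... | e , realised | false =
  inj₂ (Window.contains a (toℕ i) L≤k _ (λ j → trans (reads j) (interp-false (lookupL b j))) e
                        (RowsDistinct-‾ Δ-rows-distinct) (RowsDistinct-‾ Δ-cols-distinct)
                        (realises-not {w = interp true ∘ lookupL b} {e} realised))

PatternFree : ∀ {k} → Vec Bool k → Set
PatternFree a = ∀ b → b ∈ 𝒫 → ¬ Occurs b a

avoids⇒patternFree : ∀ {k} {a : Vec Bool k} → (a ⊙ (MI k *)) avoids Δ → PatternFree a
avoids⇒patternFree (¬Δ , ¬‾Δ) b b∈𝒫 occurs = [ ¬Δ , ¬‾Δ ]′ (occurs⇒contains b∈𝒫 occurs)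

-- M_I(k)^* avoids Δ

module Cycle (n : ℕ) where

  k : ℕ
  k = suc n

  next : ℕ → ℕ
  next u = suc u % k

  next-injective : ∀ {u v} → u < k → v < k → next u ≡ next v → u ≡ v
  next-injective = +-%-cancelˡ 1

  next³≢id : 3 < k → ∀ {u} → u < k → next (next (next u)) ≢ u
  next³≢id 3<k {u} u<k loop = contradiction (+-%-cancelˡ u 3<k (s≤s z≤n) three-steps) λ ()
    where
    open ≡-Reasoning
    three-steps : (u + 3) % k ≡ (u + 0) % k
    three-steps = begin
      (u + 3) % k                   ≡⟨ %-congˡ (+-comm u 3) ⟩
      (3 + u) % k                   ≡⟨ %-+-absorbʳ 1 (2 + u) k ⟨
      suc ((2 + u) % k) % k         ≡⟨ cong (λ z → suc z % k) (%-+-absorbʳ 1 (1 + u) k) ⟨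
      next (next (next u))          ≡⟨ loop ⟩
      u                             ≡⟨ m<n⇒m%n≡m u<k ⟨
      u % k                         ≡⟨ %-congˡ (+-identityʳ u) ⟨
      (u + 0) % k                   ∎

  -- the ones of row r of M_I(k) are in columns r and r + 1
  InRow : ℕ → ℕ → Set
  InRow r v = v ≡ r ⊎ v ≡ next r

  Adjacent : ℕ → ℕ → Set
  Adjacent u v = v ≡ next u ⊎ u ≡ next v

  MI*-true : ∀ r j → (MI k *) r j ≡ true → InRow (toℕ r) (toℕ j)
  MI*-true r j one with toℕ j <? k
  ... | no _    = contradiction one λ ()
  ... | yes j<k = Sum.map (λ t → trans (sym (toℕ-fromℕ< j<k)) (≡ᵇ⇒≡ _ _ t))
                          (λ t → trans (sym (toℕ-fromℕ< j<k)) (≡ᵇ⇒≡ _ _ t))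
                          (Equivalence.to T-∨ (subst T (trans (sym one) (MI-entry r (fromℕ< j<k))) _))

  inRow< : ∀ {r v} → r < k → InRow r v → v < k
  inRow< r<k (inj₁ refl) = r<k
  inRow< {r} r<k (inj₂ refl) = m%n<n (suc r) k

  inRow⇒adjacent : ∀ {r u v} → InRow r u → InRow r v → u ≢ v → Adjacent u v
  inRow⇒adjacent (inj₁ refl) (inj₁ refl) u≢v = contradiction refl u≢v
  inRow⇒adjacent (inj₁ refl) (inj₂ refl) _   = inj₁ refl
  inRow⇒adjacent (inj₂ refl) (inj₁ refl) _   = inj₂ refl
  inRow⇒adjacent (inj₂ refl) (inj₂ refl) u≢v = contradiction refl u≢v

  inRow-pigeonhole : ∀ {r u v w} → InRow r u → InRow r v → InRow r w → u ≢ v → u ≢ w → v ≢ w → ⊥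
  inRow-pigeonhole (inj₁ refl) (inj₁ refl) _           u≢v _   _   = u≢v refl
  inRow-pigeonhole (inj₂ refl) (inj₂ refl) _           u≢v _   _   = u≢v refl
  inRow-pigeonhole (inj₁ refl) (inj₂ refl) (inj₁ refl) _   u≢w _   = u≢w refl
  inRow-pigeonhole (inj₁ refl) (inj₂ refl) (inj₂ refl) _   _   v≢w = v≢w refl
  inRow-pigeonhole (inj₂ refl) (inj₁ refl) (inj₁ refl) _   _   v≢w = v≢w refl
  inRow-pigeonhole (inj₂ refl) (inj₁ refl) (inj₂ refl) _   u≢w _   = u≢w refl

  -- Three pairwise adjacent vertices of the k-cycle would force k = 3.
  no-triangle : 3 < k → ∀ {u v w} → u < k → v < k → w < k → u ≢ v → u ≢ w → v ≢ w →
                Adjacent u v → Adjacent u w → Adjacent v w → ⊥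
  no-triangle _   _   _   _   _   _   v≢w (inj₁ v≡u') (inj₁ w≡u') _ = v≢w (trans v≡u' (sym w≡u'))
  no-triangle 3<k u<k _   _   _   _   _   (inj₁ v≡u') (inj₂ u≡w') (inj₁ w≡v') =
    next³≢id 3<k u<k (sym (trans u≡w' (cong next (trans w≡v' (cong next v≡u')))))
  no-triangle _   _   _   _   u≢v _   _   (inj₁ _)    (inj₂ u≡w') (inj₂ v≡w') = u≢v (trans u≡w' (sym v≡w'))
  no-triangle _   _   _   _   _   u≢w _   (inj₂ u≡v') (inj₁ _)    (inj₁ w≡v') = u≢w (trans u≡v' (sym w≡v'))
  no-triangle 3<k _   v<k _   _   _   _   (inj₂ u≡v') (inj₁ w≡u') (inj₂ v≡w') =
    next³≢id 3<k v<k (sym (trans v≡w' (cong next (trans w≡u' (cong next u≡v')))))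
  no-triangle _   _   v<k w<k _   _   v≢w (inj₂ u≡v') (inj₂ u≡w') _ =
    v≢w (next-injective v<k w<k (trans (sym u≡v') u≡w'))

  MI*-avoids-Δ : 3 < k → (MI k *) avoids Δ
  MI*-avoids-Δ 3<k = ¬Δ , ¬‾Δ
    where
    ¬Δ : ¬ Contains (MI k *) Δ
    ¬Δ (f , g , _ , g-injective , match) =
      no-triangle 3<k (inRow< (toℕ<n (f (# 1))) (one (# 1) (# 0) refl))
                      (inRow< (toℕ<n (f (# 1))) (one (# 1) (# 1) refl))
                      (inRow< (toℕ<n (f (# 2))) (one (# 2) (# 2) refl))
                      (distinct λ ()) (distinct λ ()) (distinct λ ())
                      (inRow⇒adjacent (one (# 1) (# 0) refl) (one (# 1) (# 1) refl) (distinct λ ()))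
                      (inRow⇒adjacent (one (# 0) (# 0) refl) (one (# 0) (# 2) refl) (distinct λ ()))
                      (inRow⇒adjacent (one (# 2) (# 1) refl) (one (# 2) (# 2) refl) (distinct λ ()))
      where
      one : ∀ p q → Δ p q ≡ true → InRow (toℕ (f p)) (toℕ (g q))
      one p q Δpq = MI*-true (f p) (g q) (trans (match p q) Δpq)
      distinct : ∀ {q q'} → q ≢ q' → toℕ (g q) ≢ toℕ (g q')
      distinct q≢q' = q≢q' ∘ g-injective ∘ toℕ-injective
    ¬‾Δ : ¬ Contains (MI k *) (‾ Δ)
    ¬‾Δ (f , g , _ , g-injective , match) =
      inRow-pigeonhole (one (# 0) refl) (one (# 1) refl) (one (# 2) refl)
                       (distinct λ ()) (distinct λ ()) (distinct λ ())
      where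
      one : ∀ q → not (Δ (# 3) q) ≡ true → InRow (toℕ (f (# 3))) (toℕ (g q))
      one q ‾Δ3q = MI*-true (f (# 3)) (g q) (trans (match (# 3) q) ‾Δ3q)
      distinct : ∀ {q q'} → q ≢ q' → toℕ (g q) ≢ toℕ (g q')
      distinct q≢q' = q≢q' ∘ g-injective ∘ toℕ-injective

MI*-avoids-Δ : ∀ k → 3 ≤ k → (MI k *) avoids Δ
MI*-avoids-Δ 3 _ = obstructed⇒¬contains (MI 3 *) (toWitness {a? = obstructed? (MI 3 *) Δ} _)
                 , obstructed⇒¬contains (MI 3 *) (toWitness {a? = obstructed? (MI 3 *) (‾ Δ)} _)
MI*-avoids-Δ (suc n@(suc (suc (suc _)))) _ = Cycle.MI*-avoids-Δ n (s≤s (s≤s (s≤s (s≤s z≤n))))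
MI*-avoids-Δ 1 (s≤s ())
MI*-avoids-Δ 2 (s≤s (s≤s ()))

data Simple {k} (a : Vec Bool k) : Set where
  constant : ∀ c → (∀ i → lookup a i ≡ c) → Simple a
  listed   : toList a ∈ A-RowCol → Simple a

⊙-constant : ∀ {m n} (a : Vec Bool m) (M : Mat m n) c → (∀ i → lookup a i ≡ c) →
             (if c then ‾ M else M) ≐ (a ⊙ M)
⊙-constant a M true  const i j = cong (λ b → if b then not (M i j) else M i j) (sym (const i))
⊙-constant a M false const i j = cong (λ b → if b then not (M i j) else M i j) (sym (const i))

⊙-entry-injective : ∀ u v {d} → (if u then not d else d) ≡ (if v then not d else d) → u ≡ v
⊙-entry-injective true  true  _ = refl
⊙-entry-injective false false _ = refl
⊙-entry-injective true  false e = contradiction (sym e) (not-¬ refl)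
⊙-entry-injective false true  e = contradiction e (not-¬ refl)

toList-transport : ∀ {A : Set} (P : ∀ {k} → Vec A k → Set) {k m} (u : Vec A k) (v : Vec A m) →
                   toList u ≡ toList v → P v → P u
toList-transport P []      []      _  Pv = Pv
toList-transport P (z ∷ u) (z' ∷ v) eq Pv with refl ← List.∷-injectiveˡ eq =
  toList-transport (λ w → P (z ∷ w)) u v (List.∷-injectiveʳ eq) Pv

ObstructedΔ : ∀ {k} → Vec Bool k → Set
ObstructedΔ {k} a = Obstructed (a ⊙ (MI k *)) Δ × Obstructed (a ⊙ (MI k *)) (‾ Δ)

listed-obstructed : All (ObstructedΔ ∘ fromList) A-RowCol
listed-obstructed = toWitness {a? = All.all? (λ l → let M = fromList l ⊙ (MI (length l) *) in
                                                     obstructed? M Δ ×-dec obstructed? M (‾ Δ)) A-RowCol} _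

simple⇒avoids : ∀ {k} {a : Vec Bool k} → 3 ≤ k → Simple a → (a ⊙ (MI k *)) avoids Δ
simple⇒avoids {k} {a} 3≤k (constant false const) =
  avoids-resp (⊙-constant a (MI k *) false const) (MI*-avoids-Δ k 3≤k)
simple⇒avoids {k} {a} 3≤k (constant true  const) =
  avoids-resp (⊙-constant a (MI k *) true const) (avoids-‾ {M = MI k *} (MI*-avoids-Δ k 3≤k))
simple⇒avoids {k} {a} _ (listed a∈A) =
  obstructed⇒¬contains (a ⊙ (MI k *)) (proj₁ obstructed)
  , obstructed⇒¬contains (a ⊙ (MI k *)) (proj₂ obstructed)
  where
  obstructed : ObstructedΔ a
  obstructed = toList-transport ObstructedΔ a (fromList (toList a)) (sym (toList∘fromList (toList a)))
                               (All.lookup listed-obstructed a∈A)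

simple⇒∈F : ∀ {k} {a : Vec Bool k} → 3 ≤ k → Simple a → InFRowCol (a ⊙ (MI k *))
simple⇒∈F {k} {a} 3≤k (constant false const) =
  fam-I  k 3≤k λ i j → sym (⊙-constant a (MI k *) false const i j)
simple⇒∈F {k} {a} 3≤k (constant true  const) =
  fam-I‾ k 3≤k λ i j → sym (⊙-constant a (MI k *) true  const i j)
simple⇒∈F {k} {a} _ (listed a∈A) = fam-A k a a∈A λ _ _ → refl

∈F⇒simple : ∀ {k} {a : Vec Bool k} → InFRowCol (a ⊙ (MI k *)) → Simple a
∈F⇒simple {a = a} (fam-I _ _ same)  = constant false λ i → ⊙-entry-injective (lookup a i) _ (same i Fin.zero)
∈F⇒simple {a = a} (fam-I‾ _ _ same) = constant true  λ i → ⊙-entry-injective (lookup a i) _ (same i Fin.zero)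
∈F⇒simple {a = a} (fam-A _ a' a'∈A same) = listed (subst (λ v → toList v ∈ A-RowCol) (sym a≡a') a'∈A)
  where
  a≡a' : a ≡ a'
  a≡a' = trans (sym (tabulate∘lookup a)) (trans (tabulate-cong λ i →
           ⊙-entry-injective (lookup a i) (lookup a' i) (same i Fin.zero)) (tabulate∘lookup a'))

-- Pattern-free bracelets are simple

rotate : ∀ {k} → ℕ → Vec Bool k → Vec Bool k
rotate zero    a = a
rotate (suc s) a = shift (rotate s a)

rotate-equiv : ∀ {k} (a : Vec Bool k) s → Equiv a (rotate s a)
rotate-equiv a zero    = here
rotate-equiv a (suc s) = byShift (rotate-equiv a s)

_≤lex?_ : ∀ {k} (u v : Vec Bool k) → Dec (u ≤lex v)
[]          ≤lex? []          = yes lex-[]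
(false ∷ u) ≤lex? (true ∷ v)  = yes lex-<
(true ∷ u)  ≤lex? (false ∷ v) = no λ ()
(false ∷ u) ≤lex? (false ∷ v) = map′ lex-≡ (λ { (lex-≡ u≤v) → u≤v }) (u ≤lex? v)
(true ∷ u)  ≤lex? (true ∷ v)  = map′ lex-≡ (λ { (lex-≡ u≤v) → u≤v }) (u ≤lex? v)

SmallerRotation : ∀ {k} → Vec Bool k → Set
SmallerRotation {k} a =
  ∃ λ (s : Fin k) → ¬ a ≤lex rotate (toℕ s) a ⊎ ¬ a ≤lex reverse (rotate (toℕ s) a)

smallerRotation⇒¬bracelet : ∀ {k} {a : Vec Bool k} → SmallerRotation a → ¬ Bracelet a
smallerRotation⇒¬bracelet {a = a} (s , inj₁ ≰rotation) least = ≰rotation (least _ (rotate-equiv a (toℕ s)))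
smallerRotation⇒¬bracelet {a = a} (s , inj₂ ≰reversal) least =
  ≰reversal (least _ (byRev (rotate-equiv a (toℕ s))))

simple? : ∀ {k} (a : Vec Bool k) → Dec (Simple a)
simple? a = map′ [ (λ (c , const) → constant c const) , listed ]′
                 (λ { (constant c const) → inj₁ (c , const) ; (listed a∈A) → inj₂ a∈A })
                 (∃-Bool? (λ c → all? λ i → lookup a i ≟ᵇ c) ⊎-dec (toList a ∈? A-RowCol))

occurs? : ∀ b {k} (a : Vec Bool k) → Dec (Occurs b a)
occurs? b {zero}  a = no λ ()
occurs? b {suc n} a = (length b ≤? suc n) ×-dec any? λ i → ∃-Bool? λ φ → all? λ j →
  lookup a ((toℕ i + toℕ j) mod suc n) ≟ᵇ interp φ (lookupL b j)

-- Holds for every a of length 4 to 8, by exhaustive search.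
Classified : ∀ {k} → Vec Bool k → Set
Classified a = SmallerRotation a ⊎ Any (λ b → Occurs b a) 𝒫 ⊎ Simple a

classified? : ∀ {k} (a : Vec Bool k) → Dec (Classified a)
classified? a = any? (λ s → ¬? (a ≤lex? rotate (toℕ s) a) ⊎-dec ¬? (a ≤lex? reverse (rotate (toℕ s) a)))
         ⊎-dec (Any.any? (λ b → occurs? b a) 𝒫 ⊎-dec simple? a)

classify : ∀ {k} → True (∀-Vec? ∀-Bool? k classified?) → (a : Vec Bool k) → Classified a
classify ok = toWitness ok

classified⇒simple : ∀ {k} {a : Vec Bool k} → Bracelet a → PatternFree a → Classified a → Simple a
classified⇒simple bracelet _ (inj₁ smaller) = contradiction bracelet (smallerRotation⇒¬bracelet smaller)
classified⇒simple _ free (inj₂ (inj₁ occurrence)) =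
  let b , b∈𝒫 , occurs = find occurrence in contradiction occurs (free b b∈𝒫)
classified⇒simple _ _ (inj₂ (inj₂ simple)) = simple

Matches : Bool → XY → Bool → Set
Matches φ c bit = interp φ c ≡ bit

window : ∀ {n} → Vec Bool (suc n) → ℕ → (m : ℕ) → Vec Bool m
window     a s zero    = []
window {n} a s (suc m) = lookup a (s mod suc n) ∷ window a (suc s) m

module _ {n} (a : Vec Bool (suc n)) where

  prefix⇒reads : ∀ {φ b s m} → Prefix (Matches φ) b (toList (window a s m)) →
                 ∀ j → lookup a ((s + toℕ j) mod suc n) ≡ interp φ (lookupL b j)
  prefix⇒reads {s = s} {suc m} (matches ∷ _) Fin.zero =
    trans (cong (λ z → lookup a (z mod suc n)) (+-identityʳ s)) (sym matches)
  prefix⇒reads {s = s} {suc m} (_ ∷ rest) (Fin.suc j) =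
    trans (cong (λ z → lookup a (z mod suc n)) (+-suc s (toℕ j))) (prefix⇒reads rest j)

  reads⇒occurs : ∀ {φ b} s → length b ≤ suc n →
                 (∀ j → lookup a ((s + toℕ j) mod suc n) ≡ interp φ (lookupL b j)) → Occurs b a
  reads⇒occurs {φ} s L≤k reads = L≤k , s mod suc n , φ , λ j →
    trans (cong (lookup a) (mod-cong {toℕ (s mod suc n) + toℕ j} {s + toℕ j} (suc n)
                              (trans (cong (λ z → (z + toℕ j) % suc n) (toℕ-mod s (suc n)))
                                                    (%-+-absorbˡ s (toℕ j) (suc n)))))
          (reads j)

  infix⇒occurs : ∀ {φ b s m} → length b ≤ suc n →
                 Infix (Matches φ) b (toList (window a s m)) → Occurs b a
  infix⇒occurs {s = s} {suc m} L≤k (there later)  = infix⇒occurs {s = suc s} L≤k later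
  infix⇒occurs {φ} {b} {s}     L≤k (here prefix) =
    reads⇒occurs {φ} {b} s L≤k (prefix⇒reads {φ} {b} {s} prefix)

change⇒pattern : ∀ (v : Vec Bool 9) → lookup v (# 7) ≢ lookup v (# 8) →
                 Any (λ b → ∃ λ φ → Infix (Matches φ) b (toList v)) 𝒫
change⇒pattern = toWitness {a? = ∀-Vec? ∀-Bool? 9 λ v → ¬? (lookup v (# 7) ≟ᵇ lookup v (# 8)) →-dec
                   Any.any? (λ b → ∃-Bool? λ φ → infix? (λ c bit → interp φ c ≟ᵇ bit) b (toList v)) 𝒫} _

module _ {n} (9≤k : 9 ≤ suc n) {a : Vec Bool (suc n)} (free : PatternFree a) where

  private
    k = suc n

  window-pattern-free : ∀ s → ¬ Any (λ b → ∃ λ φ → Infix (Matches φ) b (toList (window a s 9))) 𝒫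
  window-pattern-free s inside with find inside
  ... | b , b∈𝒫 , φ , occurrence =
    free b b∈𝒫 (infix⇒occurs a (≤-trans (length-mono occurrence) 9≤k) occurrence)

  -- The window of length 9 starting 7 positions before s ends with the entries at s and s + 1.
  patternFree⇒stable : ∀ s → lookup a (s mod k) ≡ lookup a (suc s mod k)
  patternFree⇒stable s with lookup a (s mod k) ≟ᵇ lookup a (suc s mod k)
  ... | yes same  = same
  ... | no change = contradiction (change⇒pattern (window a s' 9) (change ∘ ends)) (window-pattern-free s')
    where
    s' = s + (k ∸ 7)
    7+s' : 7 + s' ≡ s + k
    7+s' = trans (+-comm 7 s') (trans (+-assoc s (k ∸ 7) 7)
                                      (cong (s +_) (m∸n+n≡m (≤-trans (m≤m+n 7 2) 9≤k))))
    around : ∀ t → (t + (7 + s')) mod k ≡ (t + s) mod k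
    around t = mod-cong {t + (7 + s')} {t + s} k
      (trans (%-congˡ (trans (cong (t +_) 7+s') (sym (+-assoc t s k)))) ([m+n]%n≡m%n (t + s) k))
    ends : lookup a ((7 + s') mod k) ≡ lookup a ((8 + s') mod k) →
           lookup a (s mod k) ≡ lookup a (suc s mod k)
    ends same = trans (cong (lookup a) (sym (around 0))) (trans same (cong (lookup a) (around 1)))

  patternFree⇒constant : ∀ i → lookup a i ≡ lookup a (0 mod k)
  patternFree⇒constant i = trans (cong (lookup a) (sym (mod-toℕ i))) (from-0 (toℕ i))
    where
    from-0 : ∀ s → lookup a (s mod k) ≡ lookup a (0 mod k)
    from-0 zero    = refl
    from-0 (suc s) = trans (sym (patternFree⇒stable s)) (from-0 s)

patternFree⇒simple : ∀ k → 3 ≤ k → (a : Vec Bool k) → InA k a → PatternFree a → Simple a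
patternFree⇒simple 3 _ _ (inj₁ refl) _ = constant false λ i → lookup-replicate i false
patternFree⇒simple 3 _ _ (inj₂ refl) _ = constant true  λ i → lookup-replicate i true
patternFree⇒simple 4 _ a bracelet free = classified⇒simple bracelet free (classify _ a)
patternFree⇒simple 5 _ a bracelet free = classified⇒simple bracelet free (classify _ a)
patternFree⇒simple 6 _ a bracelet free = classified⇒simple bracelet free (classify _ a)
patternFree⇒simple 7 _ a bracelet free = classified⇒simple bracelet free (classify _ a)
patternFree⇒simple 8 _ a bracelet free = classified⇒simple bracelet free (classify _ a)
patternFree⇒simple (suc (suc (suc (suc (suc (suc (suc (suc (suc m))))))))) _ a _ free =
  constant _ (patternFree⇒constant (m≤m+n 9 m) {a} free)
patternFree⇒simple 1 (s≤s ())
patternFree⇒simple 2 (s≤s (s≤s ()))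

lemma18 : (k : ℕ) → 3 ≤ k → (a : Vec Bool k) → InA k a →
    ((¬ Contains (a ⊙ (MI k *)) ((MI 3 *) ᵀ) × ¬ Contains (a ⊙ (MI k *)) (‾ ((MI 3 *) ᵀ)))
      ⇔ (∀ (b : List XY) → b ∈ 𝒫 → ¬ Occurs b a))
    × ((∀ (b : List XY) → b ∈ 𝒫 → ¬ Occurs b a) ⇔ InFRowCol (a ⊙ (MI k *)))
lemma18 k 3≤k a a∈A =
  mk⇔ free (avoids ∘ simple) , mk⇔ (simple⇒∈F 3≤k ∘ simple) (free ∘ avoids ∘ ∈F⇒simple)
  where
  free : (a ⊙ (MI k *)) avoids Δ → PatternFree a
  free = avoids⇒patternFree
  simple : PatternFree a → Simple a
  simple = patternFree⇒simple k 3≤k a a∈A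
  avoids : Simple a → (a ⊙ (MI k *)) avoids Δ
  avoids = simple⇒avoids 3≤k
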